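{- Let $q$ be a prime power and $n\geq 6$. Let $\theta_0>\theta_1>\dots>\theta_{\lfloor n/2\rfloor}$ be the distinct eigenvalues of the adjacency matrix of the alternating bilinear forms graph $\Gamma(\mathrm{Alt}_n(\mathbb{F}_q))$, and let $$t_n=\frac{q^2(q^{n-2}-1)(q^{n-3}-1)-q^{2\lfloor n/2\rfloor-2}+1}{q^{2\lfloor n/2\rfloor-2}-1}.$$ Then the largest index $s\in\{0,\dots,\lfloor n/2\rfloor\}$ such that $\theta_s\geq t_n$ is $s=\lfloor n/2\rfloor-2$.
   Context: $\mathrm{Alt}_n(\mathbb{F}_q)$ is the set of $n\times n$ alternating matrices over $\mathbb{F}_q$ (i.e. $A=-A^\top$ with zero diagonal). The alternating bilinear forms graph $\Gamma(\mathrm{Alt}_n(\mathbb{F}_q))$ has vertex set $\mathrm{Alt}_n(\mathbb{F}_q)$, with $A,B$ adjacent iff $\mathrm{rk}(A-B)=2$. Its distinct adjacency eigenvalues are $\theta_x=\frac{q^{2n-2x-1}-q^n-q^{n-1}+1}{q^2-1}$ for $x\in\{0,1,\dots,\lfloor n/2\rfloor\}$, in decreasing order. (The quantity $t_n$ equals $-\frac{\delta^2+\delta\theta_{\lfloor n/2\rfloor}-\Delta}{\delta(\theta_{\lfloor n/2\rfloor}+1)}$, where $\delta=\theta_0$ is the degree and $\Delta$ is the common diagonal entry of the cube of the adjacency matrix.) -}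

module Defs where

open import Data.Nat as ℕ using (ℕ; zero; suc; _∸_; _^_; _/_)
open import Data.Nat.Primality using (Prime)
open import Data.Product using (Σ; _×_)
open import Data.Integer as ℤ using (ℤ; +_)
open import Data.Rational as ℚ using (ℚ)
open import Relation.Binary.PropositionalEquality using (_≡_)

IsPrimePower : ℕ → Set
IsPrimePower q = Σ ℕ λ p → Σ ℕ λ k → Prime p × (q ≡ p ^ suc k)

-- a / d as a rational number, with the (irrelevant here) convention a / 0 = 0;
-- all denominators used below are nonzero when q ≥ 2.
frac : ℤ → ℕ → ℚ
frac a zero    = ℚ.0ℚ
frac a (suc d) = a ℚ./ suc d

half : ℕ → ℕ
half n = n / 2

-- θ_x = (q^(2n-2x-1) - q^n - q^(n-1) + 1) / (q^2 - 1),
-- the distinct adjacency eigenvalues of Γ(Alt_n(F_q)), x = 0 .. ⌊n/2⌋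
θ : (q n x : ℕ) → ℚ
θ q n x =
  frac (((+ (q ^ (2 ℕ.* n ∸ 2 ℕ.* x ∸ 1)) ℤ.- + (q ^ n)) ℤ.- + (q ^ (n ∸ 1))) ℤ.+ + 1)
       (q ^ 2 ∸ 1)

t : (q n : ℕ) → ℚ
t q n =
  frac (((+ (q ^ 2) ℤ.* (+ (q ^ (n ∸ 2)) ℤ.- + 1) ℤ.* (+ (q ^ (n ∸ 3)) ℤ.- + 1))
          ℤ.- + (q ^ (2 ℕ.* half n ∸ 2))) ℤ.+ + 1)
       (q ^ (2 ℕ.* half n ∸ 2) ∸ 1)

module Submission where

-- One of n − 2, n − 3 equals 2⌊n/2⌋ − 2, so the numerator of t_n is divisible by its
-- denominator and t_n = q²(q^w − 1) − 1 with w = 2⌈n/2⌉ − 3, an integer. Clearing the denominator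
-- q² − 1 of θ_x, the inequality t_n ≤ θ_x becomes q^(2n−2x−1) + q⁴ ≥ q^(2⌊n/2⌋) + q^(2⌈n/2⌉+1).
-- At x = ⌊n/2⌋ − 2 the left exponent is 2⌈n/2⌉ + 3, and q^(2⌈n/2⌉+3) alone dominates the right side;
-- for larger x it is at most 2⌈n/2⌉ + 1, while q⁴ < q^(2⌊n/2⌋) because ⌊n/2⌋ ≥ 3.

open import Defs
open import Data.Nat using (ℕ; _≤_; _<_; _∸_)
open import Data.Rational using (ℚ) renaming (_≤_ to _≤ℚ_; _<_ to _<ℚ_)
open import Data.Product using (_×_)

open import Data.Nat.Base as ℕ using (suc; z≤n; s≤s; _+_; _*_; _^_)
import Data.Nat.Properties as ℕ
import Data.Nat.Tactic.RingSolver as ℕ-Solver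
open import Data.Nat.DivMod using (_%_; m≡m%n+[m/n]*n; m%n<n; m*n/n≡m; +-distrib-/-∣ʳ; m<n⇒m/n≡0; /-monoˡ-≤)
open import Data.Nat.Divisibility using (n∣m*n)
open import Data.Nat.Primality using (prime⇒nonTrivial)
open import Data.Integer.Base as ℤ using (ℤ; +_; 0ℤ; 1ℤ; +≤+)
import Data.Integer.Properties as ℤ
import Data.Integer.Tactic.RingSolver as ℤ-Solver
import Data.Rational.Properties as ℚ
open import Data.Rational.Unnormalised.Base using (mkℚᵘ; *≤*; *<*; *≡*)
import Data.Rational.Unnormalised.Properties as ℚᵘ
open import Data.Product using (_,_)
open import Data.Sum using (_⊎_; inj₁; inj₂)
open import Relation.Binary.PropositionalEquality

frac-≤ : ∀ {a b d e} → 0 < d → 0 < e → a ℤ.* + e ℤ.≤ b ℤ.* + d → frac a d ≤ℚ frac b e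
frac-≤ {a} {b} {suc d} {suc e} _ _ h = ℚ.toℚᵘ-cancel-≤
  (ℚᵘ.≤-respˡ-≃ (ℚᵘ.≃-sym (ℚ.toℚᵘ-fromℚᵘ (mkℚᵘ a d)))
    (ℚᵘ.≤-respʳ-≃ (ℚᵘ.≃-sym (ℚ.toℚᵘ-fromℚᵘ (mkℚᵘ b e))) (*≤* h)))

frac-< : ∀ {a b d e} → 0 < d → 0 < e → a ℤ.* + e ℤ.< b ℤ.* + d → frac a d <ℚ frac b e
frac-< {a} {b} {suc d} {suc e} _ _ h = ℚ.toℚᵘ-cancel-<
  (ℚᵘ.<-respˡ-≃ (ℚᵘ.≃-sym (ℚ.toℚᵘ-fromℚᵘ (mkℚᵘ a d)))
    (ℚᵘ.<-respʳ-≃ (ℚᵘ.≃-sym (ℚ.toℚᵘ-fromℚᵘ (mkℚᵘ b e))) (*<* h)))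

frac-cancel : ∀ a {d} → 0 < d → frac (+ d ℤ.* a) d ≡ frac a 1
frac-cancel a {suc d} _ = ℚ.fromℚᵘ-cong {mkℚᵘ (+ suc d ℤ.* a) d} {mkℚᵘ a 0}
  (*≡* (trans (ℤ.*-identityʳ _) (ℤ.*-comm (+ suc d) a)))

≤-by-difference : ∀ {i j m n} → i ℤ.- j ≡ + m ℤ.- + n → n ≤ m → j ℤ.≤ i
≤-by-difference i-j≡m-n n≤m =
  ℤ.0≤i-j⇒j≤i (subst (0ℤ ℤ.≤_) (sym i-j≡m-n) (ℤ.i≤j⇒0≤j-i (+≤+ n≤m)))

<-by-difference : ∀ {i j m n} → i ℤ.- j ≡ + m ℤ.- + n → m < n → i ℤ.< j
<-by-difference {i} {j} {m} {n} i-j≡m-n m<n = ℤ.suc[i]≤j⇒i<j (≤-by-difference j-[1+i]≡n-[1+m] m<n)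
  where
  flip : ∀ x y → y ℤ.- (1ℤ ℤ.+ x) ≡ ℤ.- (x ℤ.- y) ℤ.- 1ℤ
  flip = ℤ-Solver.solve-∀
  j-[1+i]≡n-[1+m] : j ℤ.- ℤ.suc i ≡ + n ℤ.- + suc m
  j-[1+i]≡n-[1+m] = trans (flip i j) (trans (cong (λ d → ℤ.- d ℤ.- 1ℤ) i-j≡m-n) (sym (flip (+ m) (+ n))))

pos-^-+ : ∀ q i j → + (q ^ (i + j)) ≡ + (q ^ i) ℤ.* + (q ^ j)
pos-^-+ q i j = trans (cong +_ (ℕ.^-distribˡ-+-* q i j)) (ℤ.pos-* (q ^ i) (q ^ j))

pos-pred : ∀ {x} → 0 < x → + (x ∸ 1) ≡ + x ℤ.- 1ℤ
pos-pred {suc x} _ = refl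

SamePair : {A : Set} → A → A → A → A → Set
SamePair i j k l = (i ≡ k × j ≡ l) ⊎ (i ≡ l × j ≡ k)

SamePair-map : ∀ {A B : Set} (f : A → B) {i j k l} → SamePair i j k l → SamePair (f i) (f j) (f k) (f l)
SamePair-map f (inj₁ (refl , refl)) = inj₁ (refl , refl)
SamePair-map f (inj₂ (refl , refl)) = inj₂ (refl , refl)

t-numerator : (s i j u : ℤ) → ℤ
t-numerator s i j u = ((s ℤ.* (i ℤ.- + 1) ℤ.* (j ℤ.- + 1)) ℤ.- u) ℤ.+ + 1

θ-numerator : (a b c : ℤ) → ℤ
θ-numerator a b c = ((a ℤ.- b) ℤ.- c) ℤ.+ + 1

t-value : (s w : ℤ) → ℤ
t-value s w = s ℤ.* (w ℤ.- 1ℤ) ℤ.- 1ℤ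

t-numerator-factorises : ∀ s {i j u w} → SamePair i j u w → t-numerator s i j u ≡ (u ℤ.- 1ℤ) ℤ.* t-value s w
t-numerator-factorises s {u = u} {w} (inj₁ (refl , refl)) = identity s u w
  where
  identity : ∀ s u w → ((s ℤ.* (u ℤ.- 1ℤ) ℤ.* (w ℤ.- 1ℤ)) ℤ.- u) ℤ.+ 1ℤ
                       ≡ (u ℤ.- 1ℤ) ℤ.* (s ℤ.* (w ℤ.- 1ℤ) ℤ.- 1ℤ)
  identity = ℤ-Solver.solve-∀
t-numerator-factorises s {u = u} {w} (inj₂ (refl , refl)) = identity s u w
  where
  identity : ∀ s u w → ((s ℤ.* (w ℤ.- 1ℤ) ℤ.* (u ℤ.- 1ℤ)) ℤ.- u) ℤ.+ 1ℤ
                       ≡ (u ℤ.- 1ℤ) ℤ.* (s ℤ.* (w ℤ.- 1ℤ) ℤ.- 1ℤ)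
  identity = ℤ-Solver.solve-∀

θ-numerator-gap : ∀ s a {i j u w} → SamePair i j u w →
  θ-numerator a (s ℤ.* i) (s ℤ.* j) ℤ.* 1ℤ ℤ.- t-value s w ℤ.* (s ℤ.- 1ℤ)
    ≡ (a ℤ.+ s ℤ.* s) ℤ.- (s ℤ.* u ℤ.+ s ℤ.* (s ℤ.* w))
θ-numerator-gap s a {u = u} {w} (inj₁ (refl , refl)) = identity s a u w
  where
  identity : ∀ s a u w → (((a ℤ.- s ℤ.* u) ℤ.- s ℤ.* w) ℤ.+ 1ℤ) ℤ.* 1ℤ ℤ.- (s ℤ.* (w ℤ.- 1ℤ) ℤ.- 1ℤ) ℤ.* (s ℤ.- 1ℤ)
                           ≡ (a ℤ.+ s ℤ.* s) ℤ.- (s ℤ.* u ℤ.+ s ℤ.* (s ℤ.* w))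
  identity = ℤ-Solver.solve-∀
θ-numerator-gap s a {u = u} {w} (inj₂ (refl , refl)) = identity s a u w
  where
  identity : ∀ s a u w → (((a ℤ.- s ℤ.* w) ℤ.- s ℤ.* u) ℤ.+ 1ℤ) ℤ.* 1ℤ ℤ.- (s ℤ.* (w ℤ.- 1ℤ) ℤ.- 1ℤ) ℤ.* (s ℤ.- 1ℤ)
                           ≡ (a ℤ.+ s ℤ.* s) ℤ.- (s ℤ.* u ℤ.+ s ℤ.* (s ℤ.* w))
  identity = ℤ-Solver.solve-∀

power-sum-≤ : ∀ {q u w} → 1 < q → u ≤ 2 + w → q ^ (2 + u) + q ^ (4 + w) ≤ q ^ (6 + w) + q ^ 4
power-sum-≤ {q@(suc _)} {u} {w} 1<q u≤2+w = begin
  q ^ (2 + u) + q ^ (4 + w)  ≤⟨ ℕ.+-monoˡ-≤ (q ^ (4 + w)) (ℕ.^-monoʳ-≤ q (s≤s (s≤s u≤2+w))) ⟩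
  q ^ (4 + w) + q ^ (4 + w)  ≡⟨ cong (λ z → q ^ (4 + w) + z) (sym (ℕ.+-identityʳ _)) ⟩
  2 * q ^ (4 + w)            ≤⟨ ℕ.*-monoˡ-≤ (q ^ (4 + w)) (ℕ.≤-trans 1<q (ℕ.m≤m*n q (q ^ 1))) ⟩
  q ^ 2 * q ^ (4 + w)        ≡⟨ ℕ.^-distribˡ-+-* q 2 (4 + w) ⟨
  q ^ (6 + w)                ≤⟨ ℕ.m≤m+n _ _ ⟩
  q ^ (6 + w) + q ^ 4        ∎
  where open ℕ.≤-Reasoning

power-sum-< : ∀ {q a u w} → 1 < q → a ≤ 4 + w → 2 < u → q ^ a + q ^ 4 < q ^ (2 + u) + q ^ (4 + w)
power-sum-< {q@(suc _)} {a} {u} {w} 1<q a≤4+w 2<u = begin-strict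
  q ^ a + q ^ 4              <⟨ ℕ.+-mono-≤-< (ℕ.^-monoʳ-≤ q a≤4+w) (ℕ.^-monoʳ-< q 1<q (s≤s (s≤s 2<u))) ⟩
  q ^ (4 + w) + q ^ (2 + u)  ≡⟨ ℕ.+-comm (q ^ (4 + w)) (q ^ (2 + u)) ⟩
  q ^ (2 + u) + q ^ (4 + w)  ∎
  where open ℕ.≤-Reasoning

θ-exponent : ℕ → ℕ → ℕ
θ-exponent n x = 2 * n ∸ 2 * x ∸ 1

θ-exponent-antitone : ∀ n {x y} → x ≤ y → θ-exponent n y ≤ θ-exponent n x
θ-exponent-antitone n x≤y = ℕ.∸-monoˡ-≤ 1 (ℕ.∸-monoʳ-≤ (2 * n) (ℕ.*-monoʳ-≤ 2 x≤y))

-- m = ⌊n/2⌋ and w = 2⌈n/2⌉ − 3.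
record Exponents (n : ℕ) : Set where
  field
    m w             : ℕ
    half-n≡m        : half n ≡ m
    n∸2,n∸3         : SamePair (n ∸ 2) (n ∸ 3) (2 * m ∸ 2) w
    3≤2m∸2          : 3 ≤ 2 * m ∸ 2
    2m∸2≤2+w        : 2 * m ∸ 2 ≤ 2 + w
    θ-exponent-m∸2  : θ-exponent n (m ∸ 2) ≡ 6 + w
    θ-exponent-m∸1  : θ-exponent n (suc (m ∸ 2)) ≡ 4 + w

half-[e+m*2] : ∀ {e} m → e < 2 → half (e + m * 2) ≡ m
half-[e+m*2] {e} m e<2 = trans (+-distrib-/-∣ʳ e (n∣m*n m)) (cong₂ _+_ (m<n⇒m/n≡0 e<2) (m*n/n≡m m 2))

m≡n+o⇒m∸o≡n : ∀ {m n o} → m ≡ n + o → m ∸ o ≡ n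
m≡n+o⇒m∸o≡n {o = o} refl = ℕ.m+n∸n≡m _ o

exponents-of : ∀ e k → e < 2 → Exponents (e + (3 + k) * 2)
exponents-of e k e<2 = record
  { m              = 3 + k
  ; w              = 3 + e * 2 + k * 2
  ; half-n≡m       = half-[e+m*2] (3 + k) e<2
  ; n∸2,n∸3        = pair e<2
  ; 3≤2m∸2         = subst (3 ≤_) (sym 2m∸2≡) (ℕ.m≤m+n 3 _)
  ; 2m∸2≤2+w       = subst (_≤ 5 + e * 2 + k * 2) (sym 2m∸2≡) (ℕ.+-monoˡ-≤ (k * 2) (ℕ.m≤m+n 4 (1 + e * 2)))
  ; θ-exponent-m∸2 = cong (_∸ 1) (m≡n+o⇒m∸o≡n {n = 7 + (3 + e * 2 + k * 2)} (2n≡[7+w]+2[m∸2] e k))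
  ; θ-exponent-m∸1 = cong (_∸ 1) (m≡n+o⇒m∸o≡n {n = 5 + (3 + e * 2 + k * 2)} (2n≡[5+w]+2[m∸1] e k))
  }
  where
  2m∸2≡ : 2 * (3 + k) ∸ 2 ≡ 4 + k * 2
  2m∸2≡ = m≡n+o⇒m∸o≡n (2m≡[4+2k]+2 k)
    where
    2m≡[4+2k]+2 : ∀ k → 2 * (3 + k) ≡ (4 + k * 2) + 2
    2m≡[4+2k]+2 = ℕ-Solver.solve-∀
  2n≡[7+w]+2[m∸2] : ∀ e k → 2 * (e + (3 + k) * 2) ≡ (7 + (3 + e * 2 + k * 2)) + 2 * (1 + k)
  2n≡[7+w]+2[m∸2] = ℕ-Solver.solve-∀
  2n≡[5+w]+2[m∸1] : ∀ e k → 2 * (e + (3 + k) * 2) ≡ (5 + (3 + e * 2 + k * 2)) + 2 * (2 + k)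
  2n≡[5+w]+2[m∸1] = ℕ-Solver.solve-∀
  pair : ∀ {e} → e < 2 → SamePair (e + (3 + k) * 2 ∸ 2) (e + (3 + k) * 2 ∸ 3) (2 * (3 + k) ∸ 2) (3 + e * 2 + k * 2)
  pair (s≤s z≤n)       = inj₁ (sym 2m∸2≡ , refl)
  pair (s≤s (s≤s z≤n)) = inj₂ (refl , sym 2m∸2≡)

exponents : ∀ {n} → 6 ≤ n → Exponents n
exponents {n} 6≤n = subst Exponents (sym n≡e+[3+k]*2) (exponents-of (n % 2) k (m%n<n n 2))
  where
  k = half n ∸ 3
  n≡e+[3+k]*2 : n ≡ n % 2 + (3 + k) * 2
  n≡e+[3+k]*2 = trans (m≡m%n+[m/n]*n n 2) (cong (λ m → n % 2 + m * 2) (sym (ℕ.m+[n∸m]≡n (/-monoˡ-≤ 2 6≤n))))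

prime-power>1 : ∀ {q} → IsPrimePower q → 1 < q
prime-power>1 (p , k , p-prime , refl) =
  ℕ.<-≤-trans (ℕ.nonTrivial⇒n>1 p) (ℕ.m≤m*n p (p ^ k) {{ℕ.m^n≢0 p k {{ℕ.nonTrivial⇒nonZero p}}}})
  where instance _ = prime⇒nonTrivial p-prime

module _ {q n : ℕ} (1<q : 1 < q) (3≤n : 3 ≤ n) (E : Exponents n) where
  open Exponents E

  private
    u : ℕ
    u = 2 * m ∸ 2
    s : ℤ
    s = + (q ^ 2)
    τ : ℤ
    τ = t-value s (+ (q ^ w))
    1<q^k : ∀ {k} → 0 < k → 1 < q ^ k
    1<q^k = ℕ.^-monoʳ-< q 1<q {0}
    0<q² : 0 < q ^ 2
    0<q² = ℕ.<-trans (s≤s z≤n) (1<q^k {2} (s≤s z≤n))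
    0<q²∸1 : 0 < q ^ 2 ∸ 1
    0<q²∸1 = ℕ.m<n⇒0<n∸m (1<q^k {2} (s≤s z≤n))
    1<q^u : 1 < q ^ u
    1<q^u = 1<q^k (ℕ.<-≤-trans (s≤s z≤n) 3≤2m∸2)
    θ-num : ℕ → ℤ
    θ-num x = θ-numerator (+ (q ^ θ-exponent n x)) (s ℤ.* + (q ^ (n ∸ 2))) (s ℤ.* + (q ^ (n ∸ 3)))
    pair : SamePair (+ (q ^ (n ∸ 2))) (+ (q ^ (n ∸ 3))) (+ (q ^ u)) (+ (q ^ w))
    pair = SamePair-map (λ e → + (q ^ e)) n∸2,n∸3

  t-integral : t q n ≡ frac τ 1
  t-integral = begin
    t q n
      ≡⟨ cong (λ h → frac (t-numerator s i j (+ (q ^ (2 * h ∸ 2)))) (q ^ (2 * h ∸ 2) ∸ 1)) half-n≡m ⟩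
    frac (t-numerator s i j (+ (q ^ u))) (q ^ u ∸ 1)
      ≡⟨ cong (λ z → frac z (q ^ u ∸ 1)) (t-numerator-factorises s pair) ⟩
    frac ((+ (q ^ u) ℤ.- 1ℤ) ℤ.* τ) (q ^ u ∸ 1)
      ≡⟨ cong (λ z → frac (z ℤ.* τ) (q ^ u ∸ 1)) (pos-pred (ℕ.<-trans (s≤s z≤n) 1<q^u)) ⟨
    frac (+ (q ^ u ∸ 1) ℤ.* τ) (q ^ u ∸ 1)
      ≡⟨ frac-cancel τ (ℕ.m<n⇒0<n∸m 1<q^u) ⟩
    frac τ 1 ∎
    where
    open ≡-Reasoning
    i = + (q ^ (n ∸ 2))
    j = + (q ^ (n ∸ 3))

  θ-factored : ∀ x → θ q n x ≡ frac (θ-num x) (q ^ 2 ∸ 1)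
  θ-factored x =
    cong₂ (λ b c → frac (θ-numerator (+ (q ^ θ-exponent n x)) b c) (q ^ 2 ∸ 1)) q^n≡ q^[n∸1]≡
    where
    q^n≡ : + (q ^ n) ≡ s ℤ.* + (q ^ (n ∸ 2))
    q^n≡ = trans (cong (λ e → + (q ^ e)) (sym (ℕ.m+[n∸m]≡n (ℕ.≤-trans (ℕ.n≤1+n 2) 3≤n))))
                 (pos-^-+ q 2 (n ∸ 2))
    q^[n∸1]≡ : + (q ^ (n ∸ 1)) ≡ s ℤ.* + (q ^ (n ∸ 3))
    q^[n∸1]≡ = trans (cong (λ e → + (q ^ (e ∸ 1))) (sym (ℕ.m+[n∸m]≡n 3≤n))) (pos-^-+ q 2 (n ∸ 3))

  θ-minus-t : ∀ x →
    θ-num x ℤ.* + 1 ℤ.- τ ℤ.* + (q ^ 2 ∸ 1)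
      ≡ + (q ^ θ-exponent n x + q ^ 4) ℤ.- + (q ^ (2 + u) + q ^ (4 + w))
  θ-minus-t x = begin
    θ-num x ℤ.* + 1 ℤ.- τ ℤ.* + (q ^ 2 ∸ 1)
      ≡⟨ cong (λ d → θ-num x ℤ.* + 1 ℤ.- τ ℤ.* d) (pos-pred 0<q²) ⟩
    θ-num x ℤ.* + 1 ℤ.- τ ℤ.* (s ℤ.- 1ℤ)
      ≡⟨ θ-numerator-gap s a pair ⟩
    (a ℤ.+ s ℤ.* s) ℤ.- (s ℤ.* + (q ^ u) ℤ.+ s ℤ.* (s ℤ.* + (q ^ w)))
      ≡⟨ cong₂ (λ b c → (a ℤ.+ b) ℤ.- c) (pos-^-+ q 2 2) (cong₂ ℤ._+_ (pos-^-+ q 2 u) q^[4+w]≡) ⟨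
    + (q ^ θ-exponent n x + q ^ 4) ℤ.- + (q ^ (2 + u) + q ^ (4 + w)) ∎
    where
    open ≡-Reasoning
    a = + (q ^ θ-exponent n x)
    q^[4+w]≡ : + (q ^ (4 + w)) ≡ s ℤ.* (s ℤ.* + (q ^ w))
    q^[4+w]≡ = trans (pos-^-+ q 2 (2 + w)) (cong (s ℤ.*_) (pos-^-+ q 2 w))

  t≤θ[⌊n/2⌋∸2] : t q n ≤ℚ θ q n (half n ∸ 2)
  t≤θ[⌊n/2⌋∸2] = subst (λ h → t q n ≤ℚ θ q n (h ∸ 2)) (sym half-n≡m)
    (subst₂ _≤ℚ_ (sym t-integral) (sym (θ-factored (m ∸ 2)))
      (frac-≤ {τ} {θ-num (m ∸ 2)} (s≤s z≤n) 0<q²∸1 (≤-by-difference (θ-minus-t (m ∸ 2))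
        (subst (λ a → q ^ (2 + u) + q ^ (4 + w) ≤ q ^ a + q ^ 4) (sym θ-exponent-m∸2)
          (power-sum-≤ 1<q 2m∸2≤2+w)))))

  θ<t-above : ∀ x → half n ∸ 2 < x → θ q n x <ℚ t q n
  θ<t-above x ⌊n/2⌋∸2<x = subst₂ _<ℚ_ (sym (θ-factored x)) (sym t-integral)
    (frac-< {θ-num x} {τ} 0<q²∸1 (s≤s z≤n)
      (<-by-difference (θ-minus-t x) (power-sum-< 1<q θ-exponent≤4+w 3≤2m∸2)))
    where
    θ-exponent≤4+w : θ-exponent n x ≤ 4 + w
    θ-exponent≤4+w = ℕ.≤-trans (θ-exponent-antitone n (subst (λ h → h ∸ 2 < x) half-n≡m ⌊n/2⌋∸2<x))
                               (ℕ.≤-reflexive θ-exponent-m∸1)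

proposition3p19 : (q n : ℕ) → IsPrimePower q → 6 ≤ n →
    (t q n ≤ℚ θ q n (half n ∸ 2))
    × ((s : ℕ) → half n ∸ 2 < s → s ≤ half n → θ q n s <ℚ t q n)
proposition3p19 q n q-prime-power 6≤n =
  t≤θ[⌊n/2⌋∸2] 1<q 3≤n E , λ s ⌊n/2⌋∸2<s _ → θ<t-above 1<q 3≤n E s ⌊n/2⌋∸2<s
  where
  1<q = prime-power>1 q-prime-power
  3≤n = ℕ.≤-trans (ℕ.m≤m+n 3 3) 6≤n
  E = exponents 6≤n
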